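{- Every $5$-regular cyclic Cayley graph has an internal partition, except for the graphs $K_6$, $K_{5,5}$ and $\langle 1,2,5\rangle_{10}$ (up to isomorphism).
   Context: For a finite group $K$ (written additively) and $S\subseteq K$ with $0\notin S$ and $S=-S$, the Cayley graph $Cay(K;S)$ has vertex set $K$, with $x$ adjacent to $y$ iff $y=x+s$ for some $s\in S$. A cyclic Cayley graph is $Cay(\mathbb{Z}_n;S)$; for $S=\{\pm i_1,\dots,\pm i_t\}$ it is denoted $\langle i_1,\dots,i_t\rangle_n$. It is $5$-regular iff $|S|=5$. An internal partition of a graph is a partition of the vertex set into two nonempty sets such that every vertex has at least as many neighbours in its own class as in the other class. -}

module Defs where

open import Data.Nat using (ℕ; suc; _+_; _∸_; _≤_; _<ᵇ_; NonZero)
open import Data.Nat.DivMod using (_mod_)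
open import Data.Bool using (Bool; not; _xor_)
open import Data.Fin using (Fin; toℕ; zero)
open import Data.Fin.Subset using (Subset; _∈_; _∉_; ∣_∣; _∩_; ∁; Nonempty; ⁅_⁆)
open import Data.Vec using (tabulate; lookup)
open import Data.Product using (Σ; _×_)
open import Relation.Binary.PropositionalEquality using (_≡_)
open import Function.Bundles using (Bijection; _⤖_; _⇔_)

-- A (simple, loopless) graph on vertex set Fin n, given by its
-- neighbourhood function: y ∈ N x means x and y are adjacent.
Graph : ℕ → Set
Graph n = Fin n → Subset n

module _ {n : ℕ} .{{_ : NonZero n}} where
  infixl 6 _+ₙ_ _-ₙ_
  _+ₙ_ : Fin n → Fin n → Fin n
  x +ₙ y = (toℕ x + toℕ y) mod n

  -ₙ_ : Fin n → Fin n
  -ₙ x = (n ∸ toℕ x) mod n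

  _-ₙ_ : Fin n → Fin n → Fin n
  x -ₙ y = x +ₙ (-ₙ y)

  zeroₙ : Fin n
  zeroₙ = 0 mod n

ConnectionSet : (n : ℕ) .{{_ : NonZero n}} → Subset n → Set
ConnectionSet n S = (zeroₙ ∉ S) × (∀ s → s ∈ S → (-ₙ s) ∈ S)

-- Cayley graph Cay(ℤ_n ; S): y adjacent to x iff y = x + s for some s ∈ S,
-- i.e. iff y - x ∈ S (y - x being the unique s with y = x + s).
Cay : (n : ℕ) .{{_ : NonZero n}} → Subset n → Graph n
Cay n S x = tabulate (λ y → lookup S (y -ₙ x))

_≅_ : {n m : ℕ} → Graph n → Graph m → Set
_≅_ {n} {m} G H =
  Σ (Fin n ⤖ Fin m) λ f →
    ∀ x y → (y ∈ G x) ⇔ (Bijection.to f y ∈ H (Bijection.to f x))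

InternalPartition : {n : ℕ} → Graph n → Set
InternalPartition {n} G =
  Σ (Subset n) λ A →
    Nonempty A × Nonempty (∁ A) ×
    (∀ x → (x ∈ A → ∣ G x ∩ ∁ A ∣ ≤ ∣ G x ∩ A ∣)
         × (x ∉ A → ∣ G x ∩ A ∣ ≤ ∣ G x ∩ ∁ A ∣))

K6 : Graph 6
K6 x = ∁ ⁅ x ⁆

-- Complete bipartite graph K_{5,5} on Fin 10, parts {0..4} and {5..9}.
K55 : Graph 10
K55 x = tabulate (λ y → (toℕ x <ᵇ 5) xor (toℕ y <ᵇ 5))

-- ⟨1,2,5⟩_10 = Cay(ℤ_10 ; {±1, ±2, 5}) = {1,2,5,8,9}.
S1-2-5 : Subset 10
S1-2-5 = tabulate (λ (i : Fin 10) → member (toℕ i))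
  where
  member : ℕ → Bool
  member 1 = Bool.true
  member 2 = Bool.true
  member 5 = Bool.true
  member 8 = Bool.true
  member 9 = Bool.true
  member _ = Bool.false

C1-2-5 : Graph 10
C1-2-5 = Cay 10 S1-2-5

{-# OPTIONS --safe #-}
module Submission where

-- Since S is symmetric, has odd size and omits 0, it is {h, ±a, ±b} with h the unique element
-- of order two, so n = 2H for H = toℕ h. It suffices to 2-colour ℤₙ non-trivially so that every
-- x keeps the colour of at least three of x + h, x ± a, x ± b. If gcd(a, H) = g > 1 (or likewise
-- for b), colour by whether g divides x: then x + h and x ± a keep the colour. Otherwise choose w
-- with w·a ≡ 1 (mod H); the homomorphism x ↦ w·x mod H onto the cycle ℤ_H sends h, ±a, ±b to
-- 0, ±1, ±c, where replacing b by -b makes 1 ≤ c and 2c < H. Colouring by whether w·x mod H lies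
-- in [0, c] works as soon as H ≥ 2c + 2, since every point of ℤ_H then has two of its ±1, ±c
-- neighbours on its side. If H = 2c + 1 with c ≥ 3, then x ↦ -2w·x sends b ↦ 1 and -a ↦ 2, and
-- the same colouring works with c = 2. The remaining cases c ∈ {1, 2}, i.e. n ∈ {6, 10}, are
-- checked exhaustively.

open import Data.Nat
  using (ℕ; zero; suc; _+_; _*_; _∸_; _≤_; _<_; _≤?_; _<?_; _≟_; z≤n; s≤s; z<s;
         NonZero; >-nonZero; ≢-nonZero; ≢-nonZero⁻¹; >-nonZero⁻¹)
open import Data.Nat.Properties
open import Data.Nat.DivMod
open import Data.Nat.Divisibility using (_∣_; divides; ∣-trans; ∣⇒≤; n∣m⇒m%n≡0; m%n≡0⇒n∣m)
open import Data.Nat.GCD using (gcd; gcd[m,n]∣m; gcd[m,n]∣n; gcd[m,n]≢0; module Bézout)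
open import Data.Nat.Coprimality using (Coprime; coprime?; coprime-Bézout; coprime-divisor; gcd≡1⇒coprime)
import Data.Nat.Coprimality as Coprime
open import Algebra.Properties.CommutativeSemigroup *-commutativeSemigroup using (x∙yz≈y∙xz)
open import Data.Bool using (Bool; true; false)
open import Data.Fin using (Fin; zero; suc; toℕ; #_)
import Data.Fin.Properties as Fin
open import Data.Fin.Subset using (Subset; _∈_; _∉_; ∣_∣; _∩_; ∁; Nonempty)
open import Data.Fin.Subset.Properties
  using (_∈?_; x∈p∩q⁺; x∈p∩q⁻; x∈∁p⇒x∉p; x∉p⇒x∈∁p; nonempty?; anySubset?; ∣p∣≤n)
open import Data.Maybe using (Maybe; just; nothing)
open import Data.Vec using ([]; _∷_; lookup; tabulate; here; there)
open import Data.Vec.Properties using ([]=⇒lookup; lookup⇒[]=; lookup∘tabulate)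
open import Data.List using (List; []; _∷_; _++_; map; length; filter)
open import Data.List.Properties using (length-map; filter-accept; filter-≐)
open import Data.List.Membership.Propositional using () renaming (_∈_ to _∈ˡ_)
open import Data.List.Membership.Propositional.Properties using (∈-map⁺; ∈-map⁻; ∈-filter⁺; ∈-filter⁻; ∈-∃++)
open import Data.List.Membership.Propositional.Properties.WithK using (unique∧set⇒bag)
open import Data.List.Relation.Unary.Any using (Any; here; there; any?; satisfied)
open import Data.List.Relation.Unary.All using (All; []; _∷_)
import Data.List.Relation.Unary.All as All
import Data.List.Relation.Unary.All.Properties as Allₚ
open import Data.List.Relation.Unary.AllPairs using ([]; _∷_)
import Data.List.Relation.Unary.AllPairs as AllPairs
open import Data.List.Relation.Unary.Unique.Propositional using (Unique)
import Data.List.Relation.Unary.Unique.Propositional.Properties as Unique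
open import Data.List.Relation.Binary.BagAndSetEquality using (∼bag⇒↭)
open import Data.List.Relation.Binary.Permutation.Propositional
  using (_↭_; prep; swap; ↭-refl; ↭-sym; ↭-trans; ↭⇒↭ₛ)
open import Data.List.Relation.Binary.Permutation.Propositional.Properties using (∈-resp-↭; ↭-length; shift; shifts)
open import Data.List.Relation.Binary.Permutation.Setoid.Properties using (Unique-resp-↭)
open import Data.Product using (Σ; _×_; _,_; proj₁; proj₂)
open import Data.Sum using (_⊎_; inj₁; inj₂)
open import Data.Empty using (⊥; ⊥-elim)
open import Function using (_∘_; _∘₂_; id)
open import Function.Bundles using (_⇔_; mk⇔; Equivalence; mk↔ₛ′)
open import Function.Properties.Inverse using (↔⇒⤖)
open import Relation.Binary.Definitions using (DecidableEquality; tri<; tri≈; tri>)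
open import Relation.Binary.PropositionalEquality
open import Relation.Nullary using (Dec; yes; no; does; ¬_; ¬?)
open import Relation.Nullary.Decidable
  using (toWitness; dec-true; dec-false; _×-dec_; _⊎-dec_; _→-dec_; decidable-stable)
open import Relation.Unary using (Decidable)
open import Defs

elements : ∀ {n} → Subset n → List (Fin n)
elements []          = []
elements (true  ∷ p) = zero ∷ map suc (elements p)
elements (false ∷ p) = map suc (elements p)

∣p∣≡length-elements : ∀ {n} (p : Subset n) → ∣ p ∣ ≡ length (elements p)
∣p∣≡length-elements []          = refl
∣p∣≡length-elements (true  ∷ p) = cong suc (trans (∣p∣≡length-elements p) (sym (length-map suc (elements p))))
∣p∣≡length-elements (false ∷ p) = trans (∣p∣≡length-elements p) (sym (length-map suc (elements p)))

elements-unique : ∀ {n} (p : Subset n) → Unique (elements p)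
elements-unique []          = []
elements-unique (true  ∷ p) = All.tabulate zero∉ ∷ Unique.map⁺ Fin.suc-injective (elements-unique p)
  where
  zero∉ : ∀ {y} → y ∈ˡ map suc (elements p) → zero ≢ y
  zero∉ y∈ refl with ∈-map⁻ suc y∈
  ... | _ , _ , ()
elements-unique (false ∷ p) = Unique.map⁺ Fin.suc-injective (elements-unique p)

∈-elements⁺ : ∀ {n} (p : Subset n) {y} → y ∈ p → y ∈ˡ elements p
∈-elements⁺ (true  ∷ p) here       = here refl
∈-elements⁺ (true  ∷ p) (there y∈) = there (∈-map⁺ suc (∈-elements⁺ p y∈))
∈-elements⁺ (false ∷ p) (there y∈) = ∈-map⁺ suc (∈-elements⁺ p y∈)

∈-elements⁻ : ∀ {n} (p : Subset n) {y} → y ∈ˡ elements p → y ∈ p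
∈-elements⁻ (true  ∷ p) (here refl) = here
∈-elements⁻ (true  ∷ p) (there y∈) with ∈-map⁻ suc y∈
... | _ , y∈′ , refl = there (∈-elements⁻ p y∈′)
∈-elements⁻ (false ∷ p) y∈ with ∈-map⁻ suc y∈
... | _ , y∈′ , refl = there (∈-elements⁻ p y∈′)

module _ {n : ℕ} where

  Enumerates : List (Fin n) → Subset n → Set
  Enumerates xs p = Unique xs × (∀ y → y ∈ p ⇔ y ∈ˡ xs)

  elements-enumerates : ∀ p → Enumerates (elements p) p
  elements-enumerates p = elements-unique p , λ y → mk⇔ (∈-elements⁺ p) (∈-elements⁻ p)

  ∣p∣≡length : ∀ {p xs} → Enumerates xs p → ∣ p ∣ ≡ length xs
  ∣p∣≡length {p} (xs-unique , members) = trans (∣p∣≡length-elements p)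
    (↭-length (∼bag⇒↭ (unique∧set⇒bag (elements-unique p) xs-unique
      (mk⇔ (λ y∈ → Equivalence.to (members _) (∈-elements⁻ p y∈))
           (λ y∈ → ∈-elements⁺ p (Equivalence.from (members _) y∈))))))

Enumerates-resp-↭ : ∀ {n} {p : Subset n} {xs ys} → xs ↭ ys → Enumerates xs p → Enumerates ys p
Enumerates-resp-↭ xs↭ys (xs-unique , members) =
  Unique-resp-↭ (setoid _) (↭⇒↭ₛ xs↭ys) xs-unique ,
  λ y → mk⇔ (∈-resp-↭ xs↭ys ∘ Equivalence.to (members y))
            (Equivalence.from (members y) ∘ ∈-resp-↭ (↭-sym xs↭ys))

module _ {A : Set} {P : A → Set} where

  witnessed : ∀ {xs} → All (Maybe ∘ P) xs → ℕ
  witnessed []             = 0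
  witnessed (just _  ∷ ws) = suc (witnessed ws)
  witnessed (nothing ∷ ws) = witnessed ws

  witnessed≤length-filter : {Q : A → Set} (Q? : Decidable Q) → (∀ {x} → P x → Q x) →
                            {xs : List A} (ws : All (Maybe ∘ P) xs) → witnessed ws ≤ length (filter Q? xs)
  witnessed≤length-filter Q? P⇒Q []                            = z≤n
  witnessed≤length-filter Q? P⇒Q {x ∷ xs} (just px ∷ ws) rewrite filter-accept Q? {x} {xs} (P⇒Q px) =
    s≤s (witnessed≤length-filter Q? P⇒Q ws)
  witnessed≤length-filter Q? P⇒Q {x ∷ xs} (nothing ∷ ws) with Q? x
  ... | yes _ = m≤n⇒m≤1+n (witnessed≤length-filter Q? P⇒Q ws)
  ... | no  _ = witnessed≤length-filter Q? P⇒Q ws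

witnessed-map⁻ : ∀ {A B : Set} {P : A → Set} {f : B → A} {xs : List B} (ws : All (Maybe ∘ P) (map f xs)) →
                 witnessed (Allₚ.map⁻ ws) ≡ witnessed ws
witnessed-map⁻ {xs = []}     []             = refl
witnessed-map⁻ {xs = _ ∷ _} (just _  ∷ ws) = cong suc (witnessed-map⁻ ws)
witnessed-map⁻ {xs = _ ∷ _} (nothing ∷ ws) = witnessed-map⁻ ws

length-filter+length-filter-¬ : {A : Set} {P : A → Set} (P? : Decidable P) (xs : List A) →
  length (filter P? xs) + length (filter (¬? ∘ P?) xs) ≡ length xs
length-filter+length-filter-¬ P? [] = refl
length-filter+length-filter-¬ P? (x ∷ xs) with P? x
... | yes _ = cong suc (length-filter+length-filter-¬ P? xs)
... | no  _ = trans (+-suc _ _) (cong suc (length-filter+length-filter-¬ P? xs))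

+≤+⇒≤ : ∀ {a b l} → a + b ≡ l → l ≤ a + a → b ≤ a
+≤+⇒≤ {a} {b} a+b≡l l≤a+a = +-cancelˡ-≤ a b a (≤-trans (≤-reflexive a+b≡l) l≤a+a)

+-cancelʳ-<′ : ∀ {a b p t} → b + t ≡ p → a + t < p → a < b
+-cancelʳ-<′ {a} {b} {p} {t} b+t≡p a+t<p = +-cancelʳ-< t a b (subst (a + t <_) (sym b+t≡p) a+t<p)

3≤w⇒5≤w+w : ∀ {w} → 3 ≤ w → 5 ≤ w + w
3≤w⇒5≤w+w 3≤w = ≤-trans (n≤1+n 5) (+-mono-≤ 3≤w 3≤w)

-- Stated on remainders, so that congruence proofs below are ≡-Reasoning chains of remainders.
infix 4 _≡_[mod_]
_≡_[mod_] : ℕ → ℕ → (m : ℕ) .{{_ : NonZero m}} → Set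
a ≡ b [mod m ] = a % m ≡ b % m

module _ {m : ℕ} .{{_ : NonZero m}} where

  %-≡mod : ∀ a → a % m ≡ a [mod m ]
  %-≡mod a = m%n%n≡m%n a m

  +-cong-mod : ∀ {a a′ b b′} → a ≡ a′ [mod m ] → b ≡ b′ [mod m ] → a + b ≡ a′ + b′ [mod m ]
  +-cong-mod {a} {a′} {b} {b′} a≡a′ b≡b′ = begin
    (a + b) % m             ≡⟨ %-distribˡ-+ a b m ⟩
    (a % m + b % m) % m     ≡⟨ cong₂ (λ u v → (u + v) % m) a≡a′ b≡b′ ⟩
    (a′ % m + b′ % m) % m   ≡⟨ %-distribˡ-+ a′ b′ m ⟨
    (a′ + b′) % m           ∎
    where open ≡-Reasoning

  *-cong-mod : ∀ {a a′ b b′} → a ≡ a′ [mod m ] → b ≡ b′ [mod m ] → a * b ≡ a′ * b′ [mod m ]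
  *-cong-mod {a} {a′} {b} {b′} a≡a′ b≡b′ = begin
    (a * b) % m             ≡⟨ %-distribˡ-* a b m ⟩
    (a % m * (b % m)) % m   ≡⟨ cong₂ (λ u v → (u * v) % m) a≡a′ b≡b′ ⟩
    (a′ % m * (b′ % m)) % m ≡⟨ %-distribˡ-* a′ b′ m ⟨
    (a′ * b′) % m           ∎
    where open ≡-Reasoning

  +-congˡ-mod : ∀ a {b b′} → b ≡ b′ [mod m ] → a + b ≡ a + b′ [mod m ]
  +-congˡ-mod a = +-cong-mod {a} refl

  *-congˡ-mod : ∀ a {b b′} → b ≡ b′ [mod m ] → a * b ≡ a * b′ [mod m ]
  *-congˡ-mod a = *-cong-mod {a} refl

  0%m≡0 : 0 % m ≡ 0
  0%m≡0 = m<n⇒m%n≡m (>-nonZero⁻¹ m)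

  k*m≡0[mod] : ∀ k → k * m ≡ 0 [mod m ]
  k*m≡0[mod] k = trans (m*n%n≡0 k m) (sym 0%m≡0)

  m≡0[mod] : m ≡ 0 [mod m ]
  m≡0[mod] = trans (n%n≡0 m) (sym 0%m≡0)

  ≡mod⇒≡ : ∀ {a b} → a < m → b < m → a ≡ b [mod m ] → a ≡ b
  ≡mod⇒≡ a<m b<m a≡b = trans (sym (m<n⇒m%n≡m a<m)) (trans a≡b (m<n⇒m%n≡m b<m))

  +-cancelˡ-mod : ∀ c {a b} → c + a ≡ c + b [mod m ] → a ≡ b [mod m ]
  +-cancelˡ-mod c {a} {b} c+a≡c+b = begin
    a % m                ≡⟨ cancel a ⟨
    (c′ + (c + a)) % m   ≡⟨ +-congˡ-mod c′ c+a≡c+b ⟩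
    (c′ + (c + b)) % m   ≡⟨ cancel b ⟩
    b % m                ∎
    where
    open ≡-Reasoning
    c′ : ℕ
    c′ = m ∸ c % m
    c′+c≡0 : c′ + c ≡ 0 [mod m ]
    c′+c≡0 = trans (+-congˡ-mod c′ (sym (%-≡mod c)))
                   (trans (cong (_% m) (m∸n+n≡m (<⇒≤ (m%n<n c m)))) m≡0[mod])
    cancel : ∀ x → c′ + (c + x) ≡ x [mod m ]
    cancel x = trans (cong (_% m) (sym (+-assoc c′ c x))) (+-cong-mod {c′ + c} {0} c′+c≡0 refl)

≡mod-divisor : ∀ {m d} .{{_ : NonZero m}} .{{_ : NonZero d}} → d ∣ m →
               ∀ {a b} → a ≡ b [mod m ] → a ≡ b [mod d ]
≡mod-divisor {m} {d} d∣m {a} {b} a≡b =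
  trans (sym (m∣n⇒o%n%m≡o%m d m a d∣m)) (trans (cong (_% d) a≡b) (m∣n⇒o%n%m≡o%m d m b d∣m))

module _ {n : ℕ} .{{_ : NonZero n}} where

  toℕ-+ₙ : ∀ (x y : Fin n) → toℕ (x +ₙ y) ≡ toℕ x + toℕ y [mod n ]
  toℕ-+ₙ x y = trans (cong (_% n) (Fin.toℕ-fromℕ< _)) (%-≡mod _)

  toℕ-inverseˡ : ∀ (x : Fin n) → toℕ (-ₙ x) + toℕ x ≡ 0 [mod n ]
  toℕ-inverseˡ x = trans (+-cong-mod {a = toℕ (-ₙ x)} (trans (cong (_% n) (Fin.toℕ-fromℕ< _)) (%-≡mod _)) refl)
                   (trans (cong (_% n) (m∸n+n≡m (<⇒≤ (Fin.toℕ<n x)))) m≡0[mod])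

  toℕ-zeroₙ : toℕ (zeroₙ {n}) ≡ 0
  toℕ-zeroₙ = trans (Fin.toℕ-fromℕ< _) 0%m≡0

  toℕ-≡mod⇒≡ : ∀ {x y : Fin n} → toℕ x ≡ toℕ y [mod n ] → x ≡ y
  toℕ-≡mod⇒≡ {x} {y} = Fin.toℕ-injective ∘ ≡mod⇒≡ (Fin.toℕ<n x) (Fin.toℕ<n y)

  toℕ[x-ₙy]+toℕy≡toℕx : ∀ (x y : Fin n) → toℕ (x -ₙ y) + toℕ y ≡ toℕ x [mod n ]
  toℕ[x-ₙy]+toℕy≡toℕx x y = begin
    (toℕ (x -ₙ y) + toℕ y) % n           ≡⟨ +-cong-mod {a = toℕ (x -ₙ y)} (toℕ-+ₙ x (-ₙ y)) refl ⟩
    (toℕ x + toℕ (-ₙ y) + toℕ y) % n     ≡⟨ cong (_% n) (+-assoc (toℕ x) _ _) ⟩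
    (toℕ x + (toℕ (-ₙ y) + toℕ y)) % n   ≡⟨ +-congˡ-mod (toℕ x) (toℕ-inverseˡ y) ⟩
    (toℕ x + 0) % n                      ≡⟨ cong (_% n) (+-identityʳ (toℕ x)) ⟩
    toℕ x % n                            ∎
    where open ≡-Reasoning

  x+ₙ[y-ₙx]≡y : ∀ (x y : Fin n) → x +ₙ (y -ₙ x) ≡ y
  x+ₙ[y-ₙx]≡y x y = toℕ-≡mod⇒≡ (trans (toℕ-+ₙ x (y -ₙ x))
    (trans (cong (_% n) (+-comm (toℕ x) _)) (toℕ[x-ₙy]+toℕy≡toℕx y x)))

  [x+ₙs]-ₙx≡s : ∀ (x s : Fin n) → (x +ₙ s) -ₙ x ≡ s
  [x+ₙs]-ₙx≡s x s = toℕ-≡mod⇒≡ (+-cancelˡ-mod (toℕ x)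
    (trans (cong (_% n) (+-comm (toℕ x) _)) (trans (toℕ[x-ₙy]+toℕy≡toℕx (x +ₙ s) x) (toℕ-+ₙ x s))))

  +ₙ-cancelˡ : ∀ (x : Fin n) {s t} → x +ₙ s ≡ x +ₙ t → s ≡ t
  +ₙ-cancelˡ x {s} {t} eq = trans (sym ([x+ₙs]-ₙx≡s x s)) (trans (cong (_-ₙ x) eq) ([x+ₙs]-ₙx≡s x t))

  -ₙ-involutive : ∀ (x : Fin n) → -ₙ (-ₙ x) ≡ x
  -ₙ-involutive x = toℕ-≡mod⇒≡ (+-cancelˡ-mod (toℕ (-ₙ x))
    (trans (cong (_% n) (+-comm _ (toℕ (-ₙ (-ₙ x))))) (trans (toℕ-inverseˡ (-ₙ x)) (sym (toℕ-inverseˡ x)))))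

  *-toℕ-inverseˡ : ∀ k (s : Fin n) → k * toℕ (-ₙ s) + k * toℕ s ≡ 0 [mod n ]
  *-toℕ-inverseˡ k s = begin
    (k * toℕ (-ₙ s) + k * toℕ s) % n ≡⟨ cong (_% n) (*-distribˡ-+ k _ _) ⟨
    (k * (toℕ (-ₙ s) + toℕ s)) % n   ≡⟨ *-congˡ-mod k (toℕ-inverseˡ s) ⟩
    (k * 0) % n                      ≡⟨ cong (_% n) (*-zeroʳ k) ⟩
    0 % n                            ∎
    where open ≡-Reasoning

module Neighbourhoods {n : ℕ} .{{_ : NonZero n}} {S : Subset n} {gens : List (Fin n)}
                      (gens-enumerates : Enumerates gens S) where

  private
    gens-unique : Unique gens
    gens-unique = proj₁ gens-enumerates
    ∈S⇔∈gens : ∀ s → s ∈ S ⇔ s ∈ˡ gens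
    ∈S⇔∈gens = proj₂ gens-enumerates

  ∈-Cay⇔ : ∀ {x y} → y ∈ Cay n S x ⇔ y -ₙ x ∈ S
  ∈-Cay⇔ {x} {y} = mk⇔
    (λ y∈ → lookup⇒[]= (y -ₙ x) S (trans (sym (lookup∘tabulate _ y)) ([]=⇒lookup y∈)))
    (λ y-x∈ → lookup⇒[]= y (Cay n S x) (trans (lookup∘tabulate _ y) ([]=⇒lookup y-x∈)))

  neighbours-enumerate : ∀ x B →
    Enumerates (map (x +ₙ_) (filter (λ s → x +ₙ s ∈? B) gens)) (Cay n S x ∩ B)
  neighbours-enumerate x B =
    Unique.map⁺ (+ₙ-cancelˡ x) (Unique.filter⁺ _ gens-unique) , λ y → mk⇔ (to y) (from y)
    where
    to : ∀ y → y ∈ Cay n S x ∩ B → y ∈ˡ map (x +ₙ_) (filter (λ s → x +ₙ s ∈? B) gens)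
    to y y∈ with x∈p∩q⁻ (Cay n S x) B y∈
    ... | y∈N , y∈B = subst (_∈ˡ _) (x+ₙ[y-ₙx]≡y x y) (∈-map⁺ (x +ₙ_)
      (∈-filter⁺ _ (Equivalence.to (∈S⇔∈gens _) (Equivalence.to (∈-Cay⇔ {x} {y}) y∈N))
                   (subst (_∈ B) (sym (x+ₙ[y-ₙx]≡y x y)) y∈B)))
    from : ∀ y → y ∈ˡ map (x +ₙ_) (filter (λ s → x +ₙ s ∈? B) gens) → y ∈ Cay n S x ∩ B
    from y y∈ with ∈-map⁻ (x +ₙ_) y∈
    ... | s , s∈ , refl with ∈-filter⁻ _ s∈
    ...   | s∈gens , x+s∈B = x∈p∩q⁺
      (Equivalence.from (∈-Cay⇔ {x} {x +ₙ s})
         (subst (_∈ S) (sym ([x+ₙs]-ₙx≡s x s)) (Equivalence.from (∈S⇔∈gens s) s∈gens)) , x+s∈B)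

  ∣N∩B∣≡length-filter : ∀ x B → ∣ Cay n S x ∩ B ∣ ≡ length (filter (λ s → x +ₙ s ∈? B) gens)
  ∣N∩B∣≡length-filter x B =
    trans (∣p∣≡length (neighbours-enumerate x B)) (length-map (x +ₙ_) (filter (λ s → x +ₙ s ∈? B) gens))

  ∣N∩B∣+∣N∩∁B∣≡degree : ∀ x B → ∣ Cay n S x ∩ B ∣ + ∣ Cay n S x ∩ ∁ B ∣ ≡ length gens
  ∣N∩B∣+∣N∩∁B∣≡degree x B = begin
    ∣ Cay n S x ∩ B ∣ + ∣ Cay n S x ∩ ∁ B ∣
      ≡⟨ cong₂ _+_ (∣N∩B∣≡length-filter x B) (∣N∩B∣≡length-filter x (∁ B)) ⟩
    length (filter (λ s → x +ₙ s ∈? B) gens) + length (filter (λ s → x +ₙ s ∈? ∁ B) gens)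
      ≡⟨ cong (length (filter (λ s → x +ₙ s ∈? B) gens) +_)
              (cong length (filter-≐ _ _ (x∈∁p⇒x∉p , x∉p⇒x∈∁p) gens)) ⟩
    length (filter (λ s → x +ₙ s ∈? B) gens) + length (filter (¬? ∘ λ s → x +ₙ s ∈? B) gens)
      ≡⟨ length-filter+length-filter-¬ _ gens ⟩
    length gens ∎
    where open ≡-Reasoning

  witnessed≤∣N∩B∣ : ∀ {P : Fin n → Set} x B → (∀ {s} → P s → x +ₙ s ∈ B) →
                   (ws : All (Maybe ∘ P) gens) → witnessed ws ≤ ∣ Cay n S x ∩ B ∣
  witnessed≤∣N∩B∣ x B P⇒x+s∈B ws = subst (witnessed ws ≤_) (sym (∣N∩B∣≡length-filter x B))
    (witnessed≤length-filter (λ s → x +ₙ s ∈? B) P⇒x+s∈B ws)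

  SameColour : (Fin n → Bool) → Fin n → Fin n → Set
  SameColour colour x s = colour (x +ₙ s) ≡ colour x

  MostlySameColour : (Fin n → Bool) → Fin n → Set
  MostlySameColour colour x =
    Σ (All (Maybe ∘ SameColour colour x) gens) λ ws → length gens ≤ witnessed ws + witnessed ws

  internalPartition-by-colouring : (colour : Fin n → Bool) {u v : Fin n} →
    colour u ≡ true → colour v ≡ false → (∀ x → MostlySameColour colour x) →
    InternalPartition (Cay n S)
  internalPartition-by-colouring colour {u} {v} u-true v-false mostly =
    A , (u , true⇒∈A u-true) , (v , x∉p⇒x∈∁p (false⇒∉A v-false)) ,
    λ x → in-A x (mostly x) , not-in-A x (mostly x)
    where
    A : Subset n
    A = tabulate colour
    ∈A⇔true : ∀ {x} → x ∈ A ⇔ colour x ≡ true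
    ∈A⇔true {x} = mk⇔ (λ x∈A → trans (sym (lookup∘tabulate colour x)) ([]=⇒lookup x∈A))
                      (λ c → lookup⇒[]= x A (trans (lookup∘tabulate colour x) c))
    true⇒∈A : ∀ {x} → colour x ≡ true → x ∈ A
    true⇒∈A = Equivalence.from ∈A⇔true
    false⇒∉A : ∀ {x} → colour x ≡ false → x ∉ A
    false⇒∉A c x∈A with trans (sym c) (Equivalence.to ∈A⇔true x∈A)
    ... | ()
    in-A : ∀ x → MostlySameColour colour x → x ∈ A → ∣ Cay n S x ∩ ∁ A ∣ ≤ ∣ Cay n S x ∩ A ∣
    in-A x (ws , deg≤2w) x∈A =
      +≤+⇒≤ (∣N∩B∣+∣N∩∁B∣≡degree x A) (≤-trans deg≤2w (+-mono-≤ w≤ w≤))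
      where
      w≤ : witnessed ws ≤ ∣ Cay n S x ∩ A ∣
      w≤ = witnessed≤∣N∩B∣ x A (λ same → true⇒∈A (trans same (Equivalence.to ∈A⇔true x∈A))) ws
    not-in-A : ∀ x → MostlySameColour colour x → x ∉ A → ∣ Cay n S x ∩ A ∣ ≤ ∣ Cay n S x ∩ ∁ A ∣
    not-in-A x (ws , deg≤2w) x∉A =
      +≤+⇒≤ (trans (+-comm ∣ Cay n S x ∩ ∁ A ∣ _) (∣N∩B∣+∣N∩∁B∣≡degree x A))
            (≤-trans deg≤2w (+-mono-≤ w≤ w≤))
      where
      colour-false : colour x ≡ false
      colour-false with colour x in eq
      ... | true  = ⊥-elim (x∉A (true⇒∈A eq))
      ... | false = refl
      w≤ : witnessed ws ≤ ∣ Cay n S x ∩ ∁ A ∣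
      w≤ = witnessed≤∣N∩B∣ x (∁ A) (λ same → x∉p⇒x∈∁p (false⇒∉A (trans same colour-false))) ws

module Involution {T : Set} (_≟_ : DecidableEquality T) (ν : T → T) (ν-involutive : ∀ x → ν (ν x) ≡ x) where

  Closed : List T → Set
  Closed xs = ∀ {x} → x ∈ˡ xs → ν x ∈ˡ xs

  pairs : List T → List T
  pairs []       = []
  pairs (p ∷ ps) = p ∷ ν p ∷ pairs ps

  record Pairing (xs : List T) : Set where
    field
      fixedPoints representatives : List T
      fixed : All (λ f → ν f ≡ f) fixedPoints
      partition : fixedPoints ++ pairs representatives ↭ xs

  private
    ν-swap : ∀ {x y} → ν y ≡ x → y ≡ ν x
    ν-swap {x} {y} νy≡x = trans (sym (ν-involutive y)) (cong ν νy≡x)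

    ν-injective : ∀ {x y} → ν x ≡ ν y → x ≡ y
    ν-injective {x} {y} eq = trans (sym (ν-involutive x)) (trans (cong ν eq) (ν-involutive y))

    ∈-tail : ∀ {x y : T} {xs} → y ≢ x → y ∈ˡ x ∷ xs → y ∈ˡ xs
    ∈-tail y≢x (here y≡x) = ⊥-elim (y≢x y≡x)
    ∈-tail y≢x (there y∈) = y∈

    -- Recursion on the bound k, since removing ν x from the tail is not structural.
    pairing-bounded : ∀ k xs → length xs ≤ k → Unique xs → Closed xs → Pairing xs
    pairing-bounded k [] _ _ _ = record { fixedPoints = [] ; representatives = [] ; fixed = [] ; partition = ↭-refl }
    pairing-bounded (suc k) (x ∷ xs) (s≤s |xs|≤k) (x∉xs ∷ xs-unique) closed with ν x ≟ x
    ... | yes νx≡x = record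
      { fixedPoints = x ∷ fixedPoints ; representatives = representatives
      ; fixed = νx≡x ∷ fixed ; partition = prep x partition }
      where
      closed-xs : Closed xs
      closed-xs {y} y∈ with closed (there y∈)
      ... | here νy≡x = ⊥-elim (All.lookup x∉xs y∈ (sym (trans (ν-swap νy≡x) νx≡x)))
      ... | there νy∈ = νy∈
      open Pairing (pairing-bounded k xs |xs|≤k xs-unique closed-xs)
    ... | no νx≢x with ys , zs , xs≡ ← ∈-∃++ (∈-tail νx≢x (closed (here refl))) = record
      { fixedPoints = fixedPoints ; representatives = x ∷ representatives ; fixed = fixed
      ; partition = ↭-trans (shifts fixedPoints (x ∷ ν x ∷ []))
                            (prep x (↭-trans (prep (ν x) partition) (↭-sym xs↭))) }
      where
      rest : List T
      rest = ys ++ zs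
      xs↭ : xs ↭ ν x ∷ rest
      xs↭ = subst (_↭ ν x ∷ rest) (sym xs≡) (shift (ν x) ys zs)
      νx∷rest-unique : Unique (ν x ∷ rest)
      νx∷rest-unique = Unique-resp-↭ (setoid T) (↭⇒↭ₛ xs↭) xs-unique
      |rest|≤k : length rest ≤ k
      |rest|≤k = ≤-trans (n≤1+n _)
        (subst (_≤ k) (↭-length xs↭) |xs|≤k)
      closed-rest : Closed rest
      closed-rest {y} y∈ with closed (there (∈-resp-↭ (↭-sym xs↭) (there y∈)))
      ... | here νy≡x =
        ⊥-elim (All.lookup (AllPairs.head νx∷rest-unique) y∈ (sym (ν-swap νy≡x)))
      ... | there νy∈ with ∈-resp-↭ xs↭ νy∈
      ...   | here νy≡νx =
        ⊥-elim (All.lookup x∉xs (∈-resp-↭ (↭-sym xs↭) (there y∈)) (sym (ν-injective νy≡νx)))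
      ...   | there νy∈rest = νy∈rest
      open Pairing (pairing-bounded k rest |rest|≤k (AllPairs.tail νx∷rest-unique) closed-rest)

  pairing : ∀ xs → Unique xs → Closed xs → Pairing xs
  pairing xs = pairing-bounded (length xs) xs ≤-refl

module _ {n : ℕ} .{{_ : NonZero n}} where

  -ₙx≡x⇒n≡2x : ∀ (x : Fin n) → x ≢ zeroₙ → -ₙ x ≡ x → n ≡ 2 * toℕ x
  -ₙx≡x⇒n≡2x x x≢0 -x≡x = begin
    n                 ≡⟨ m∸n+n≡m (<⇒≤ (Fin.toℕ<n x)) ⟨
    n ∸ toℕ x + toℕ x ≡⟨ cong (_+ toℕ x) n∸x≡x ⟩
    toℕ x + toℕ x     ≡⟨ cong (toℕ x +_) (+-identityʳ (toℕ x)) ⟨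
    2 * toℕ x         ∎
    where
    open ≡-Reasoning
    x>0 : 0 < toℕ x
    x>0 = n≢0⇒n>0 λ x≡0 → x≢0 (Fin.toℕ-injective (trans x≡0 (sym toℕ-zeroₙ)))
    n∸x≡x : n ∸ toℕ x ≡ toℕ x
    n∸x≡x = trans (sym (m<n⇒m%n≡m (∸-monoʳ-< x>0 (<⇒≤ (Fin.toℕ<n x)))))
                  (trans (sym (Fin.toℕ-fromℕ< _)) (cong toℕ -x≡x))

  generators : (a b h : Fin n) → List (Fin n)
  generators a b h = h ∷ a ∷ -ₙ a ∷ b ∷ -ₙ b ∷ []

  record Shape (S : Subset n) : Set where
    field
      a b h : Fin n
      enumerates : Enumerates (generators a b h) S
      n≡2h : n ≡ 2 * toℕ h

  shape : (S : Subset n) → ConnectionSet n S → ∣ S ∣ ≡ 5 → Shape S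
  shape S (0∉S , S-symmetric) |S|≡5 = from-pairing (pairing (elements S) (elements-unique S) closed)
    where
    open Involution Fin._≟_ -ₙ_ -ₙ-involutive
    closed : Closed (elements S)
    closed y∈ = ∈-elements⁺ S (S-symmetric _ (∈-elements⁻ S y∈))
    ∈S⇒≢0 : ∀ {x} → x ∈ S → x ≢ zeroₙ
    ∈S⇒≢0 x∈S refl = 0∉S x∈S
    shape-of : ∀ fs ps → All (λ f → -ₙ f ≡ f) fs → Enumerates (fs ++ pairs ps) S →
               length (fs ++ pairs ps) ≡ 5 → Shape S
    shape-of (h ∷ []) (a ∷ b ∷ []) (-h≡h ∷ []) enum _ = record
      { a = a ; b = b ; h = h ; enumerates = enum
      ; n≡2h = -ₙx≡x⇒n≡2x h (∈S⇒≢0 (Equivalence.from (proj₂ enum h) (here refl))) -h≡h }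
    shape-of (f ∷ g ∷ _) _ (-f≡f ∷ -g≡g ∷ _) enum _ = ⊥-elim (All.head (AllPairs.head (proj₁ enum)) f≡g)
      where
      f∈S : f ∈ S
      f∈S = Equivalence.from (proj₂ enum f) (here refl)
      g∈S : g ∈ S
      g∈S = Equivalence.from (proj₂ enum g) (there (here refl))
      f≡g : f ≡ g
      f≡g = Fin.toℕ-injective (*-cancelˡ-≡ (toℕ f) (toℕ g) 2
        (trans (sym (-ₙx≡x⇒n≡2x f (∈S⇒≢0 f∈S) -f≡f)) (-ₙx≡x⇒n≡2x g (∈S⇒≢0 g∈S) -g≡g)))
    shape-of []      []                  _ _ ()
    shape-of []      (_ ∷ [])            _ _ ()
    shape-of []      (_ ∷ _ ∷ [])        _ _ ()
    shape-of []      (_ ∷ _ ∷ _ ∷ _)     _ _ ()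
    shape-of (_ ∷ []) []                 _ _ ()
    shape-of (_ ∷ []) (_ ∷ [])           _ _ ()
    shape-of (_ ∷ []) (_ ∷ _ ∷ _ ∷ _)    _ _ ()
    from-pairing : Pairing (elements S) → Shape S
    from-pairing P = shape-of fixedPoints representatives fixed
      (Enumerates-resp-↭ (↭-sym partition) (elements-enumerates S))
      (trans (↭-length partition) (trans (sym (∣p∣≡length-elements S)) |S|≡5))
      where open Pairing P

  swap-generators : ∀ {S : Subset n} → Shape S → Shape S
  swap-generators σ = record
    { a = b ; b = a ; h = h ; n≡2h = n≡2h
    ; enumerates = Enumerates-resp-↭ (prep h (shifts (a ∷ -ₙ a ∷ []) (b ∷ -ₙ b ∷ []))) enumerates }
    where open Shape σ

  negate-b : ∀ {S : Subset n} → Shape S → Shape S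
  negate-b σ = record
    { a = a ; b = -ₙ b ; h = h ; n≡2h = n≡2h
    ; enumerates = subst (λ b′ → Enumerates (h ∷ a ∷ -ₙ a ∷ -ₙ b ∷ b′ ∷ []) _) (sym (-ₙ-involutive b))
        (Enumerates-resp-↭ (prep h (prep a (prep (-ₙ a) (swap b (-ₙ b) ↭-refl)))) enumerates) }
    where open Shape σ

module IntervalOnCycle (H : ℕ) .{{_ : NonZero H}} (c : ℕ) (1≤c : 1 ≤ c) (2c+2≤H : 2 + (c + c) ≤ H) where

  low : ℕ → Bool
  low z = does (z ≤? c)

  SameSide : ℕ → ℕ → Set
  SameSide p q = low q ≡ low p

  both-low : ∀ {p q} → q ≤ c → p ≤ c → SameSide p q
  both-low {p} {q} q≤c p≤c = trans (dec-true (q ≤? c) q≤c) (sym (dec-true (p ≤? c) p≤c))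

  both-high : ∀ {p q} → c < q → c < p → SameSide p q
  both-high {p} {q} c<q c<p = trans (dec-false (q ≤? c) (<⇒≱ c<q)) (sym (dec-false (p ≤? c) (<⇒≱ c<p)))

  c<H : c < H
  c<H = ≤-trans (s≤s (m≤m+n c c)) (≤-trans (n≤1+n _) 2c+2≤H)

  ≡mod⇒≡-up : ∀ p t {q} → p + t < H → q < H → q ≡ p + t [mod H ] → q ≡ p + t
  ≡mod⇒≡-up p t p+t<H q<H = ≡mod⇒≡ q<H p+t<H

  ≡mod⇒≡-down : ∀ {p q t} → t ≤ p → p < H → q < H → p ≡ q + t [mod H ] → q + t ≡ p
  ≡mod⇒≡-down {p} {q} {t} t≤p p<H q<H p≡q+t with q + t <? H
  ... | yes q+t<H = ≡mod⇒≡ q+t<H p<H (sym p≡q+t)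
  ... | no  q+t≮H = ⊥-elim (<-irrefl refl (<-≤-trans q+t<p+H (≤-reflexive (sym q+t≡p+H))))
    where
    H≤q+t : H ≤ q + t
    H≤q+t = ≮⇒≥ q+t≮H
    q+t∸H≡p : q + t ∸ H ≡ p
    q+t∸H≡p = ≡mod⇒≡
      (+-cancelʳ-< H _ H (subst (_< H + H) (sym (m∸n+n≡m H≤q+t)) (+-mono-< q<H (≤-<-trans t≤p p<H))))
      p<H (trans (m≤n⇒[n∸m]%m≡n%m H≤q+t) (sym p≡q+t))
    q+t≡p+H : q + t ≡ p + H
    q+t≡p+H = trans (sym (m∸n+n≡m H≤q+t)) (cong (_+ H) q+t∸H≡p)
    q+t<p+H : q + t < p + H
    q+t<p+H = subst (_< p + H) (+-comm t q) (+-mono-≤-< t≤p q<H)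

  record Neighbours (p : ℕ) : Set where
    field
      next prev next-c prev-c : ℕ
      next<H : next < H
      prev<H : prev < H
      next-c<H : next-c < H
      prev-c<H : prev-c < H
      next≡ : next ≡ p + 1 [mod H ]
      prev≡ : p ≡ prev + 1 [mod H ]
      next-c≡ : next-c ≡ p + c [mod H ]
      prev-c≡ : p ≡ prev-c + c [mod H ]

    positions : List ℕ
    positions = next ∷ prev ∷ next-c ∷ prev-c ∷ []

  TwoOnSameSide : (p : ℕ) → Neighbours p → Set
  TwoOnSameSide p ν = Σ (All (Maybe ∘ SameSide p) (Neighbours.positions ν)) λ ws → 2 ≤ witnessed ws

  below-c : ∀ {p} → p < c → (ν : Neighbours p) → TwoOnSameSide p ν
  below-c {p} p<c ν with p ≟ 0
  ... | yes refl = just (both-low next≤c z≤n) ∷ nothing ∷ just (both-low next-c≤c z≤n) ∷ nothing ∷ [] , ≤-refl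
    where
    open Neighbours ν
    next≤c : next ≤ c
    next≤c = ≤-trans (≤-reflexive (≡mod⇒≡-up 0 1 (≤-<-trans 1≤c c<H) next<H next≡)) 1≤c
    next-c≤c : next-c ≤ c
    next-c≤c = ≤-reflexive (≡mod⇒≡-up 0 c c<H next-c<H next-c≡)
  ... | no p≢0 = just (both-low next≤c p≤c) ∷ just (both-low (<⇒≤ (<-≤-trans prev<p p≤c)) p≤c)
                 ∷ nothing ∷ nothing ∷ [] , ≤-refl
    where
    open Neighbours ν
    p≤c : p ≤ c
    p≤c = <⇒≤ p<c
    p+1≤c : p + 1 ≤ c
    p+1≤c = subst (_≤ c) (+-comm 1 p) p<c
    next≤c : next ≤ c
    next≤c = subst (_≤ c) (sym (≡mod⇒≡-up p 1 (≤-<-trans p+1≤c c<H) next<H next≡)) p+1≤c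
    prev<p : prev < p
    prev<p = subst (prev <_) (≡mod⇒≡-down (n≢0⇒n>0 p≢0) (<-trans p<c c<H) prev<H prev≡) (m<m+n prev z<s)

  at-c : (ν : Neighbours c) → TwoOnSameSide c ν
  at-c ν = nothing ∷ just (both-low (<⇒≤ prev<c) ≤-refl) ∷ nothing ∷ just (both-low prev-c≤c ≤-refl) ∷ []
         , ≤-refl
    where
    open Neighbours ν
    prev<c : prev < c
    prev<c = subst (prev <_) (≡mod⇒≡-down 1≤c c<H prev<H prev≡) (m<m+n prev z<s)
    prev-c≤c : prev-c ≤ c
    prev-c≤c = subst (_≤ c) (sym (+-cancelʳ-≡ c prev-c 0 (≡mod⇒≡-down ≤-refl c<H prev-c<H prev-c≡))) z≤n

  above-c : ∀ {p} → c < p → p < H → (ν : Neighbours p) → TwoOnSameSide p ν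
  above-c {p} c<p p<H ν with p ≟ suc c
  ... | yes refl = just (both-high c<next c<p) ∷ nothing ∷ just (both-high c<next-c c<p) ∷ nothing ∷ [] , ≤-refl
    where
    open Neighbours ν
    p+c<H : p + c < H
    p+c<H = 2c+2≤H
    c<next : c < next
    c<next = subst (c <_) (sym (≡mod⇒≡-up p 1 (≤-<-trans (+-monoʳ-≤ p 1≤c) p+c<H) next<H next≡))
               (≤-trans c<p (m≤m+n p 1))
    c<next-c : c < next-c
    c<next-c = subst (c <_) (sym (≡mod⇒≡-up p c p+c<H next-c<H next-c≡)) (≤-trans c<p (m≤m+n p c))
  ... | no p≢1+c with suc p <? H
  ...   | yes 1+p<H = just (both-high c<next c<p) ∷ just (both-high c<prev c<p) ∷ nothing ∷ nothing ∷ [] , ≤-refl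
    where
    open Neighbours ν
    c<next : c < next
    c<next = subst (c <_) (sym (≡mod⇒≡-up p 1 (subst (_< H) (+-comm 1 p) 1+p<H) next<H next≡))
               (≤-trans c<p (m≤m+n p 1))
    c<prev : c < prev
    c<prev = +-cancelʳ-<′ (≡mod⇒≡-down (≤-trans (s≤s z≤n) c<p) p<H prev<H prev≡)
               (subst (_< p) (+-comm 1 c) (≤∧≢⇒< c<p (p≢1+c ∘ sym)))
  ...   | no 1+p≮H = nothing ∷ just (both-high c<prev c<p) ∷ nothing ∷ just (both-high c<prev-c c<p) ∷ [] , ≤-refl
    where
    open Neighbours ν
    2c<p : c + c < p
    2c<p = ≤-pred (subst (2 + (c + c) ≤_) (sym (≤-antisym p<H (≮⇒≥ 1+p≮H))) 2c+2≤H)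
    c<prev : c < prev
    c<prev = +-cancelʳ-<′ (≡mod⇒≡-down (≤-trans (s≤s z≤n) c<p) p<H prev<H prev≡)
               (≤-<-trans (+-monoʳ-≤ c 1≤c) 2c<p)
    c<prev-c : c < prev-c
    c<prev-c = +-cancelʳ-<′ (≡mod⇒≡-down (<⇒≤ c<p) p<H prev-c<H prev-c≡) 2c<p

  two-on-same-side : ∀ {p} → p < H → (ν : Neighbours p) → TwoOnSameSide p ν
  two-on-same-side {p} p<H with <-cmp p c
  ... | tri< p<c _ _  = below-c p<c
  ... | tri≈ _ refl _ = at-c
  ... | tri> _ _ c<p  = above-c c<p p<H

module Projection {n H : ℕ} .{{_ : NonZero n}} .{{_ : NonZero H}} (H∣n : H ∣ n) (w : ℕ) where

  pos : Fin n → ℕ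
  pos y = (w * toℕ y) % H

  pos-+ : ∀ x s → pos (x +ₙ s) ≡ pos x + w * toℕ s [mod H ]
  pos-+ x s = begin
    pos (x +ₙ s) % H              ≡⟨ %-≡mod _ ⟩
    (w * toℕ (x +ₙ s)) % H        ≡⟨ *-congˡ-mod w (≡mod-divisor H∣n (toℕ-+ₙ x s)) ⟩
    (w * (toℕ x + toℕ s)) % H     ≡⟨ cong (_% H) (*-distribˡ-+ w (toℕ x) (toℕ s)) ⟩
    (w * toℕ x + w * toℕ s) % H   ≡⟨ +-cong-mod (sym (%-≡mod (w * toℕ x))) refl ⟩
    (pos x + w * toℕ s) % H       ∎
    where open ≡-Reasoning

  step-+ : ∀ x s {t} → w * toℕ s ≡ t [mod H ] → pos (x +ₙ s) ≡ pos x + t [mod H ]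
  step-+ x s ws≡t = trans (pos-+ x s) (+-congˡ-mod (pos x) ws≡t)

  step-− : ∀ x s {t} → w * toℕ s ≡ t [mod H ] → pos x ≡ pos (x +ₙ -ₙ s) + t [mod H ]
  step-− x s {t} ws≡t = sym (begin
    (pos (x +ₙ -ₙ s) + t) % H                      ≡⟨ +-congˡ-mod (pos (x +ₙ -ₙ s)) ws≡t ⟨
    (pos (x +ₙ -ₙ s) + w * toℕ s) % H              ≡⟨ +-cong-mod (step-+ x (-ₙ s) refl) refl ⟩
    (pos x + w * toℕ (-ₙ s) + w * toℕ s) % H       ≡⟨ cong (_% H) (+-assoc (pos x) _ _) ⟩
    (pos x + (w * toℕ (-ₙ s) + w * toℕ s)) % H
      ≡⟨ +-congˡ-mod (pos x) (≡mod-divisor H∣n (*-toℕ-inverseˡ w s)) ⟩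
    (pos x + 0) % H                                ≡⟨ cong (_% H) (+-identityʳ (pos x)) ⟩
    pos x % H                                      ∎)
    where open ≡-Reasoning

module _ {n : ℕ} .{{_ : NonZero n}} {S : Subset n} (σ : Shape S) where

  open Shape σ
  open Neighbourhoods enumerates

  residue-partition : ∀ d .{{_ : NonZero d}} → 2 ≤ d → d ∣ n →
    toℕ a ≡ 0 [mod d ] → toℕ h ≡ 0 [mod d ] → InternalPartition (Cay n S)
  residue-partition d 2≤d d∣n a≡0 h≡0 =
    internalPartition-by-colouring colour colour-0 colour-1 λ x →
      just (multiple-keeps-colour x h h≡0) ∷ just (multiple-keeps-colour x a a≡0) ∷
      just (multiple-keeps-colour x (-ₙ a) -a≡0) ∷ nothing ∷ nothing ∷ [] , 3≤w⇒5≤w+w ≤-refl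
    where
    colour : Fin n → Bool
    colour x = does (toℕ x % d ≟ 0)
    multiple-keeps-colour : ∀ x s → toℕ s ≡ 0 [mod d ] → SameColour colour x s
    multiple-keeps-colour x s s≡0 = cong (λ r → does (r ≟ 0)) (begin
      toℕ (x +ₙ s) % d    ≡⟨ ≡mod-divisor d∣n (toℕ-+ₙ x s) ⟩
      (toℕ x + toℕ s) % d ≡⟨ +-congˡ-mod (toℕ x) s≡0 ⟩
      (toℕ x + 0) % d     ≡⟨ cong (_% d) (+-identityʳ (toℕ x)) ⟩
      toℕ x % d           ∎)
      where open ≡-Reasoning
    -a≡0 : toℕ (-ₙ a) ≡ 0 [mod d ]
    -a≡0 = trans (cong (_% d) (sym (+-identityʳ _)))
             (trans (+-congˡ-mod (toℕ (-ₙ a)) (sym a≡0)) (≡mod-divisor d∣n (toℕ-inverseˡ a)))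
    colour-0 : colour zeroₙ ≡ true
    colour-0 = dec-true (toℕ (zeroₙ {n}) % d ≟ 0) (trans (cong (_% d) toℕ-zeroₙ) 0%m≡0)
    1<n : 1 < n
    1<n = ≤-trans 2≤d (∣⇒≤ d∣n)
    colour-1 : colour (1 mod n) ≡ false
    colour-1 = dec-false (toℕ (1 mod n) % d ≟ 0) λ 1%d≡0 → 1+n≢0 (trans (sym (m<n⇒m%n≡m 2≤d))
      (trans (cong (_% d) (sym (trans (Fin.toℕ-fromℕ< _) (m<n⇒m%n≡m 1<n)))) 1%d≡0))

  interval-partition : ∀ w c .{{_ : NonZero (toℕ h)}} → 1 ≤ c → 2 + (c + c) ≤ toℕ h →
    w * toℕ a ≡ 1 [mod toℕ h ] → w * toℕ b ≡ c [mod toℕ h ] → InternalPartition (Cay n S)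
  interval-partition w c 1≤c 2c+2≤H wa≡1 wb≡c =
    internalPartition-by-colouring colour colour-0 colour-1+c λ x →
      mostly-same-colour x (two-on-same-side (m%n<n _ H) (neighbours x))
    where
    H : ℕ
    H = toℕ h
    open IntervalOnCycle H c 1≤c 2c+2≤H
    open ≡-Reasoning
    open Projection (divides 2 n≡2h) w
    colour : Fin n → Bool
    colour = low ∘ pos
    neighbours : ∀ x → Neighbours (pos x)
    neighbours x = record
      { next = pos (x +ₙ a) ; prev = pos (x +ₙ -ₙ a) ; next-c = pos (x +ₙ b) ; prev-c = pos (x +ₙ -ₙ b)
      ; next<H = m%n<n _ H ; prev<H = m%n<n _ H ; next-c<H = m%n<n _ H ; prev-c<H = m%n<n _ H
      ; next≡ = step-+ x a wa≡1 ; prev≡ = step-− x a wa≡1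
      ; next-c≡ = step-+ x b wb≡c ; prev-c≡ = step-− x b wb≡c }
    h-keeps-colour : ∀ x → SameColour colour x h
    h-keeps-colour x = cong low (≡mod⇒≡ (m%n<n _ H) (m%n<n _ H)
      (trans (step-+ x h (trans (m*n%n≡0 w H) (sym 0%m≡0))) (cong (_% H) (+-identityʳ (pos x)))))
    colour-0 : colour zeroₙ ≡ true
    colour-0 = dec-true (pos zeroₙ ≤? c) (≤-trans (≤-reflexive pos0≡0) z≤n)
      where
      pos0≡0 : pos zeroₙ ≡ 0
      pos0≡0 = trans (cong (λ z → (w * z) % H) toℕ-zeroₙ) (trans (cong (_% H) (*-zeroʳ w)) 0%m≡0)
    colour-1+c : colour (((1 + c) * toℕ a) mod n) ≡ false
    colour-1+c = dec-false (pos v ≤? c) (<⇒≱ (≤-reflexive (sym posv≡1+c)))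
      where
      v : Fin n
      v = ((1 + c) * toℕ a) mod n
      toℕv≡ : toℕ v ≡ (1 + c) * toℕ a [mod n ]
      toℕv≡ = trans (cong (_% n) (Fin.toℕ-fromℕ< _)) (%-≡mod _)
      posv≡1+c : pos v ≡ 1 + c
      posv≡1+c = ≡mod⇒≡ (m%n<n _ H) (≤-trans (s≤s (s≤s (m≤m+n c c))) 2c+2≤H) (begin
        pos v % H                     ≡⟨ %-≡mod _ ⟩
        (w * toℕ v) % H               ≡⟨ *-congˡ-mod w (≡mod-divisor (divides 2 n≡2h) toℕv≡) ⟩
        (w * ((1 + c) * toℕ a)) % H   ≡⟨ cong (_% H) (x∙yz≈y∙xz w (1 + c) (toℕ a)) ⟩
        ((1 + c) * (w * toℕ a)) % H   ≡⟨ *-congˡ-mod (1 + c) wa≡1 ⟩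
        ((1 + c) * 1) % H             ≡⟨ cong (_% H) (*-identityʳ (1 + c)) ⟩
        (1 + c) % H                   ∎)
    mostly-same-colour : ∀ x → TwoOnSameSide (pos x) (neighbours x) → MostlySameColour colour x
    mostly-same-colour x (ws , 2≤ws) =
      just (h-keeps-colour x) ∷ Allₚ.map⁻ {f = pos ∘ (x +ₙ_)} ws ,
      3≤w⇒5≤w+w (s≤s (subst (2 ≤_) (sym (witnessed-map⁻ {f = pos ∘ (x +ₙ_)} ws)) 2≤ws))

inverse-mod : ∀ {a m} .{{_ : NonZero m}} → Coprime a m → Σ ℕ λ w → w * a ≡ 1 [mod m ]
inverse-mod {a} {m} coprime with coprime-Bézout coprime
... | Bézout.+- x y eq = x , trans (cong (_% m) (sym eq)) ([m+kn]%n≡m%n 1 y m)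
-- Here x·a ≡ -1, so (m ∸ 1)·x inverts a.
... | Bézout.-+ x y eq = (m ∸ 1) * x , +-cancelˡ-mod (m ∸ 1) (begin
  (m ∸ 1 + (m ∸ 1) * x * a) % m       ≡⟨ cong (λ z → (m ∸ 1 + z) % m) (*-assoc (m ∸ 1) x a) ⟩
  (m ∸ 1 + (m ∸ 1) * (x * a)) % m     ≡⟨ cong (λ z → (z + (m ∸ 1) * (x * a)) % m) (*-identityʳ (m ∸ 1)) ⟨
  ((m ∸ 1) * 1 + (m ∸ 1) * (x * a)) % m ≡⟨ cong (_% m) (*-distribˡ-+ (m ∸ 1) 1 (x * a)) ⟨
  ((m ∸ 1) * (1 + x * a)) % m         ≡⟨ cong (λ z → ((m ∸ 1) * z) % m) eq ⟩
  ((m ∸ 1) * (y * m)) % m             ≡⟨ cong (_% m) (*-assoc (m ∸ 1) y m) ⟨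
  ((m ∸ 1) * y * m) % m               ≡⟨ k*m≡0[mod] ((m ∸ 1) * y) ⟩
  0 % m                               ≡⟨ m≡0[mod] ⟨
  m % m                               ≡⟨ cong (_% m) (m∸n+n≡m (>-nonZero⁻¹ m)) ⟨
  (m ∸ 1 + 1) % m                     ∎)
  where open ≡-Reasoning

≢0∧≢1⇒2≤ : ∀ {m} → m ≢ 0 → m ≢ 1 → 2 ≤ m
≢0∧≢1⇒2≤ {0}           m≢0 _   = ⊥-elim (m≢0 refl)
≢0∧≢1⇒2≤ {1}           _   m≢1 = ⊥-elim (m≢1 refl)
≢0∧≢1⇒2≤ {suc (suc _)} _   _   = s≤s (s≤s z≤n)

module _ {H : ℕ} .{{_ : NonZero H}} where

  inverse-cancel : ∀ {w a} → w * a ≡ 1 [mod H ] → ∀ x → a * (w * x) ≡ x [mod H ]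
  inverse-cancel {w} {a} wa≡1 x = begin
    (a * (w * x)) % H ≡⟨ cong (_% H) (trans (sym (*-assoc a w x)) (cong (_* x) (*-comm a w))) ⟩
    (w * a * x) % H   ≡⟨ *-cong-mod wa≡1 refl ⟩
    (1 * x) % H       ≡⟨ cong (_% H) (*-identityˡ x) ⟩
    x % H             ∎
    where open ≡-Reasoning

  coprime-multiple : ∀ {b k} → Coprime b H → b * k ≡ 0 [mod H ] → H ∣ k
  coprime-multiple {b} {k} coprime bk≡0 =
    coprime-divisor (Coprime.sym coprime) (m%n≡0⇒n∣m (b * k) H (trans bk≡0 0%m≡0))

  -ₙ-≡mod : ∀ {n} .{{_ : NonZero n}} → H ∣ n → ∀ k (s : Fin n) {t t′} →
            k * toℕ s ≡ t [mod H ] → t + t′ ≡ 0 [mod H ] → k * toℕ (-ₙ s) ≡ t′ [mod H ]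
  -ₙ-≡mod H∣n k s {t} {t′} ks≡t t+t′≡0 = +-cancelˡ-mod t (begin
    (t + k * toℕ (-ₙ s)) % H           ≡⟨ +-cong-mod (sym ks≡t) refl ⟩
    (k * toℕ s + k * toℕ (-ₙ s)) % H   ≡⟨ cong (_% H) (+-comm (k * toℕ s) _) ⟩
    (k * toℕ (-ₙ s) + k * toℕ s) % H   ≡⟨ ≡mod-divisor H∣n (*-toℕ-inverseˡ k s) ⟩
    0 % H                              ≡⟨ t+t′≡0 ⟨
    (t + t′) % H                       ∎)
    where open ≡-Reasoning

module _ {n : ℕ} .{{_ : NonZero n}} {S : Subset n} (σ : Shape S) where

  open Shape σ

  private
    H∣n : toℕ h ∣ n
    H∣n = divides 2 n≡2h

  half-interval-case : ∀ w c .{{_ : NonZero (toℕ h)}} → toℕ h ≢ 3 → toℕ h ≢ 5 →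
    1 ≤ c → toℕ h ≡ 1 + (c + c) →
    w * toℕ a ≡ 1 [mod toℕ h ] → w * toℕ b ≡ c [mod toℕ h ] → InternalPartition (Cay n S)
  half-interval-case w 0 _ _ () _ _ _
  half-interval-case w 1 H≢3 _ _ H≡3 _ _ = ⊥-elim (H≢3 H≡3)
  half-interval-case w 2 _ H≢5 _ H≡5 _ _ = ⊥-elim (H≢5 H≡5)
  half-interval-case w c@(suc (suc (suc _))) _ _ _ H≡1+2c wa≡1 wb≡c =
    interval-partition (negate-b (swap-generators σ)) w′ 2 (s≤s z≤n) 6≤H w′b≡1 w′[-a]≡2
    where
    open ≡-Reasoning
    H : ℕ
    H = toℕ h
    3≤c : 3 ≤ c
    3≤c = s≤s (s≤s (s≤s z≤n))
    6≤H : 6 ≤ H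
    6≤H = subst (6 ≤_) (sym H≡1+2c) (≤-trans (n≤1+n 6) (s≤s (+-mono-≤ 3≤c 3≤c)))
    2≤H : 2 ≤ H
    2≤H = ≤-trans (s≤s (s≤s z≤n)) 6≤H
    w′ : ℕ
    w′ = (H ∸ 2) * w
    [H∸2]c≡1 : (H ∸ 2) * c ≡ 1 [mod H ]
    [H∸2]c≡1 = +-cancelˡ-mod (c + c) (begin
      (c + c + (H ∸ 2) * c) % H ≡⟨ cong (_% H) (+-assoc c c _) ⟩
      ((2 + (H ∸ 2)) * c) % H   ≡⟨ cong (λ z → (z * c) % H) (m+[n∸m]≡n 2≤H) ⟩
      (H * c) % H               ≡⟨ trans (cong (_% H) (*-comm H c)) (k*m≡0[mod] c) ⟩
      0 % H                     ≡⟨ m≡0[mod] ⟨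
      H % H                     ≡⟨ cong (_% H) (trans H≡1+2c (+-comm 1 (c + c))) ⟩
      (c + c + 1) % H           ∎)
    w′b≡1 : w′ * toℕ b ≡ 1 [mod H ]
    w′b≡1 = trans (cong (_% H) (*-assoc (H ∸ 2) w (toℕ b))) (trans (*-congˡ-mod (H ∸ 2) wb≡c) [H∸2]c≡1)
    w′a≡H∸2 : w′ * toℕ a ≡ H ∸ 2 [mod H ]
    w′a≡H∸2 = trans (cong (_% H) (*-assoc (H ∸ 2) w (toℕ a)))
                (trans (*-congˡ-mod (H ∸ 2) wa≡1) (cong (_% H) (*-identityʳ (H ∸ 2))))
    w′[-a]≡2 : w′ * toℕ (-ₙ a) ≡ 2 [mod H ]
    w′[-a]≡2 = -ₙ-≡mod H∣n w′ a w′a≡H∸2 (trans (cong (_% H) (m∸n+n≡m 2≤H)) m≡0[mod])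

  oriented-case : ∀ w c .{{_ : NonZero (toℕ h)}} → toℕ h ≢ 3 → toℕ h ≢ 5 → 1 ≤ c → c + c < toℕ h →
    w * toℕ a ≡ 1 [mod toℕ h ] → w * toℕ b ≡ c [mod toℕ h ] → InternalPartition (Cay n S)
  oriented-case w c H≢3 H≢5 1≤c 2c<H wa≡1 wb≡c with 2 + (c + c) ≤? toℕ h
  ... | yes 2c+2≤H = interval-partition σ w c 1≤c 2c+2≤H wa≡1 wb≡c
  ... | no  2c+2≰H = half-interval-case w c H≢3 H≢5 1≤c (≤-antisym (≮⇒≥ 2c+2≰H) 2c<H) wa≡1 wb≡c

  residue-by-gcd : .{{_ : NonZero (toℕ h)}} → gcd (toℕ a) (toℕ h) ≢ 1 → InternalPartition (Cay n S)
  residue-by-gcd g≢1 = residue-partition σ g {{g-nonZero}} 2≤g (∣-trans (gcd[m,n]∣n (toℕ a) (toℕ h)) H∣n)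
                         (divides⇒≡0 (gcd[m,n]∣m (toℕ a) (toℕ h))) (divides⇒≡0 (gcd[m,n]∣n (toℕ a) (toℕ h)))
    where
    g : ℕ
    g = gcd (toℕ a) (toℕ h)
    g≢0 : g ≢ 0
    g≢0 = gcd[m,n]≢0 (toℕ a) (toℕ h) (inj₂ (≢-nonZero⁻¹ (toℕ h)))
    g-nonZero : NonZero g
    g-nonZero = ≢-nonZero g≢0
    2≤g : 2 ≤ g
    2≤g = ≢0∧≢1⇒2≤ g≢0 g≢1
    divides⇒≡0 : ∀ {x} → g ∣ x → _≡_[mod_] x 0 g {{g-nonZero}}
    divides⇒≡0 {x} g∣x = trans (n∣m⇒m%n≡0 x g {{g-nonZero}} g∣x) (sym (0%m≡0 {{g-nonZero}}))

module _ {n : ℕ} .{{_ : NonZero n}} {S : Subset n} (σ : Shape S) where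

  open Shape σ

  private
    H∣n : toℕ h ∣ n
    H∣n = divides 2 n≡2h

  choose-orientation : ∀ w c₀ .{{_ : NonZero (toℕ h)}} → toℕ h ≢ 3 → toℕ h ≢ 5 →
    c₀ ≢ 0 → c₀ < toℕ h → c₀ + c₀ ≢ toℕ h →
    w * toℕ a ≡ 1 [mod toℕ h ] → w * toℕ b ≡ c₀ [mod toℕ h ] → InternalPartition (Cay n S)
  choose-orientation w c₀ H≢3 H≢5 c₀≢0 c₀<H 2c₀≢H wa≡1 wb≡c₀ with c₀ + c₀ <? toℕ h
  ... | yes 2c₀<H = oriented-case σ w c₀ H≢3 H≢5 (n≢0⇒n>0 c₀≢0) 2c₀<H wa≡1 wb≡c₀
  ... | no  2c₀≮H = oriented-case (negate-b σ) w c H≢3 H≢5 1≤c 2c<H wa≡1 w[-b]≡c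
    where
    H : ℕ
    H = toℕ h
    c : ℕ
    c = H ∸ c₀
    c+c₀≡H : c + c₀ ≡ H
    c+c₀≡H = m∸n+n≡m (<⇒≤ c₀<H)
    1≤c : 1 ≤ c
    1≤c = +-cancelʳ-≤ c₀ 1 c (subst (suc c₀ ≤_) (sym c+c₀≡H) c₀<H)
    2c<H : c + c < H
    2c<H = subst (c + c <_) c+c₀≡H (+-monoʳ-< c (+-cancelʳ-< c₀ c c₀
             (subst (_< c₀ + c₀) (sym c+c₀≡H) (≤∧≢⇒< (≮⇒≥ 2c₀≮H) (2c₀≢H ∘ sym)))))
    w[-b]≡c : w * toℕ (-ₙ b) ≡ c [mod H ]
    w[-b]≡c = -ₙ-≡mod H∣n w b wb≡c₀ (trans (cong (_% H) (trans (+-comm c₀ c) c+c₀≡H)) m≡0[mod])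

  coprime-case : .{{_ : NonZero (toℕ h)}} → 3 ≤ toℕ h → toℕ h ≢ 3 → toℕ h ≢ 5 →
    Coprime (toℕ a) (toℕ h) → Coprime (toℕ b) (toℕ h) → InternalPartition (Cay n S)
  coprime-case 3≤H H≢3 H≢5 a⊥H b⊥H =
    choose-orientation w c₀ H≢3 H≢5 c₀≢0 (m%n<n _ H) 2c₀≢H wa≡1 (sym (%-≡mod (w * toℕ b)))
    where
    open ≡-Reasoning
    H : ℕ
    H = toℕ h
    w : ℕ
    w = proj₁ (inverse-mod a⊥H)
    wa≡1 : w * toℕ a ≡ 1 [mod H ]
    wa≡1 = proj₂ (inverse-mod a⊥H)
    c₀ : ℕ
    c₀ = (w * toℕ b) % H
    small-multiple : ∀ k → 0 < k → k < 3 → w * (toℕ b * k) ≡ 0 [mod H ] → ⊥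
    small-multiple k 0<k k<3 wbk≡0 =
      <⇒≱ (≤-<-trans (∣⇒≤ {{>-nonZero 0<k}} (coprime-multiple b⊥H bk≡0)) k<3) 3≤H
      where
      bk≡0 : toℕ b * k ≡ 0 [mod H ]
      bk≡0 = trans (sym (inverse-cancel {w = w} {a = toℕ a} wa≡1 (toℕ b * k)))
               (trans (*-congˡ-mod (toℕ a) wbk≡0) (cong (_% H) (*-zeroʳ (toℕ a))))
    c₀≢0 : c₀ ≢ 0
    c₀≢0 c₀≡0 = small-multiple 1 z<s (s≤s (s≤s z≤n))
      (trans (cong (λ z → (w * z) % H) (*-identityʳ (toℕ b))) (trans c₀≡0 (sym 0%m≡0)))
    2c₀≢H : c₀ + c₀ ≢ H
    2c₀≢H 2c₀≡H = small-multiple 2 z<s ≤-refl (begin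
      (w * (toℕ b * 2)) % H ≡⟨ cong (_% H) (trans (cong (w *_) (*-comm (toℕ b) 2)) (x∙yz≈y∙xz w 2 (toℕ b))) ⟩
      (2 * (w * toℕ b)) % H ≡⟨ *-congˡ-mod 2 (sym (%-≡mod (w * toℕ b))) ⟩
      (2 * c₀) % H          ≡⟨ cong (λ z → (c₀ + z) % H) (+-identityʳ c₀) ⟩
      (c₀ + c₀) % H         ≡⟨ cong (_% H) 2c₀≡H ⟩
      H % H                 ≡⟨ m≡0[mod] ⟩
      0 % H                 ∎)

  general-case : .{{_ : NonZero (toℕ h)}} → 3 ≤ toℕ h → toℕ h ≢ 3 → toℕ h ≢ 5 → InternalPartition (Cay n S)
  general-case 3≤H H≢3 H≢5 with coprime? (toℕ a) (toℕ h) | coprime? (toℕ b) (toℕ h)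
  ... | no ¬a⊥H | _       = residue-by-gcd σ (¬a⊥H ∘ gcd≡1⇒coprime)
  ... | yes _   | no ¬b⊥H = residue-by-gcd (swap-generators σ) (¬b⊥H ∘ gcd≡1⇒coprime)
  ... | yes a⊥H | yes b⊥H = coprime-case 3≤H H≢3 H≢5 a⊥H b⊥H

_⇔-dec_ : ∀ {P Q : Set} → Dec P → Dec Q → Dec (P ⇔ Q)
P? ⇔-dec Q? with P? →-dec Q? | Q? →-dec P?
... | yes to | yes from = yes (mk⇔ to from)
... | no ¬to | _        = no (¬to ∘ Equivalence.to)
... | _      | no ¬from = no (¬from ∘ Equivalence.from)

module _ {m : ℕ} where

  all-subsets? : {P : Subset m → Set} → (∀ p → Dec (P p)) → Dec (∀ p → P p)
  all-subsets? P? with anySubset? (¬? ∘ P?)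
  ... | yes (p , ¬Pp) = no λ ∀P → ¬Pp (∀P p)
  ... | no ¬∃¬P       = yes λ p → decidable-stable (P? p) λ ¬Pp → ¬∃¬P (p , ¬Pp)

  connectionSet? : .{{_ : NonZero m}} → (S : Subset m) → Dec (ConnectionSet m S)
  connectionSet? S = ¬? (zeroₙ ∈? S) ×-dec Fin.all? λ s → s ∈? S →-dec -ₙ s ∈? S

  IsInternalPartition : Graph m → Subset m → Set
  IsInternalPartition G A = Nonempty A × Nonempty (∁ A) ×
    (∀ x → (x ∈ A → ∣ G x ∩ ∁ A ∣ ≤ ∣ G x ∩ A ∣) ×
           (x ∉ A → ∣ G x ∩ A ∣ ≤ ∣ G x ∩ ∁ A ∣))

  isInternalPartition? : ∀ G A → Dec (IsInternalPartition G A)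
  isInternalPartition? G A = nonempty? A ×-dec nonempty? (∁ A) ×-dec Fin.all? λ x →
    (x ∈? A →-dec ∣ G x ∩ ∁ A ∣ ≤? ∣ G x ∩ A ∣) ×-dec
    (¬? (x ∈? A) →-dec ∣ G x ∩ A ∣ ≤? ∣ G x ∩ ∁ A ∣)

  IsomorphismVia : (f g : Fin m → Fin m) → Graph m → Graph m → Set
  IsomorphismVia f g G H =
    (∀ y → f (g y) ≡ y) × (∀ x → g (f x) ≡ x) × (∀ x y → y ∈ G x ⇔ f y ∈ H (f x))

  isomorphismVia? : ∀ f g G H → Dec (IsomorphismVia f g G H)
  isomorphismVia? f g G H = Fin.all? (λ y → f (g y) Fin.≟ y) ×-dec Fin.all? (λ x → g (f x) Fin.≟ x)
    ×-dec Fin.all? λ x → Fin.all? λ y → (y ∈? G x) ⇔-dec (f y ∈? H (f x))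

  IsomorphismVia⇒≅ : ∀ f g G H → IsomorphismVia f g G H → G ≅ H
  IsomorphismVia⇒≅ f g G H (fg , gf , adjacency) = ↔⇒⤖ (mk↔ₛ′ f g fg gf) , adjacency

order-6 : (S : Subset 6) → ConnectionSet 6 S → ∣ S ∣ ≡ 5 → Cay 6 S ≅ K6
order-6 S = IsomorphismVia⇒≅ id id (Cay 6 S) K6 ∘₂ toWitness {a? = all-subsets? certificate?} _ S
  where
  Certificate : Subset 6 → Set
  Certificate S = ConnectionSet 6 S → ∣ S ∣ ≡ 5 → IsomorphismVia id id (Cay 6 S) K6
  certificate? : ∀ S → Dec (Certificate S)
  certificate? S = connectionSet? S →-dec (∣ S ∣ ≟ 5 →-dec isomorphismVia? id id (Cay 6 S) K6)

-- Sends the even residues onto the part {0,…,4} of K55 and the odd ones onto {5,…,9}.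
halve : Fin 10 → Fin 10
halve = lookup (# 0 ∷ # 5 ∷ # 1 ∷ # 6 ∷ # 2 ∷ # 7 ∷ # 3 ∷ # 8 ∷ # 4 ∷ # 9 ∷ [])

unhalve : Fin 10 → Fin 10
unhalve = lookup (# 0 ∷ # 2 ∷ # 4 ∷ # 6 ∷ # 8 ∷ # 1 ∷ # 3 ∷ # 5 ∷ # 7 ∷ # 9 ∷ [])

-- Multiplication by the unit 3 of ℤ₁₀ maps {3,4,5,6,7} onto {1,2,5,8,9}.
times3 : Fin 10 → Fin 10
times3 = lookup (# 0 ∷ # 3 ∷ # 6 ∷ # 9 ∷ # 2 ∷ # 5 ∷ # 8 ∷ # 1 ∷ # 4 ∷ # 7 ∷ [])

times7 : Fin 10 → Fin 10
times7 = lookup (# 0 ∷ # 7 ∷ # 4 ∷ # 1 ∷ # 8 ∷ # 5 ∷ # 2 ∷ # 9 ∷ # 6 ∷ # 3 ∷ [])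

evens residues-0-2-mod-5 residues-0-1-mod-5 : Subset 10
evens              = true ∷ false ∷ true  ∷ false ∷ true  ∷ false ∷ true  ∷ false ∷ true  ∷ false ∷ []
residues-0-2-mod-5 = true ∷ false ∷ true  ∷ false ∷ false ∷ true  ∷ false ∷ true  ∷ false ∷ false ∷ []
residues-0-1-mod-5 = true ∷ true  ∷ false ∷ false ∷ false ∷ true  ∷ true  ∷ false ∷ false ∷ false ∷ []

Order10Certificate : Subset 10 → Set
Order10Certificate S =
  IsomorphismVia halve unhalve (Cay 10 S) K55 ⊎
  Any (λ (f , g) → IsomorphismVia f g (Cay 10 S) C1-2-5) ((id , id) ∷ (times3 , times7) ∷ []) ⊎
  Any (IsInternalPartition (Cay 10 S)) (evens ∷ residues-0-2-mod-5 ∷ residues-0-1-mod-5 ∷ [])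

order-10-certificate : (S : Subset 10) → ConnectionSet 10 S → ∣ S ∣ ≡ 5 → Order10Certificate S
order-10-certificate = toWitness {a? = all-subsets? certificate?} _
  where
  certificate? : ∀ S → Dec (ConnectionSet 10 S → ∣ S ∣ ≡ 5 → Order10Certificate S)
  certificate? S = connectionSet? S →-dec (∣ S ∣ ≟ 5 →-dec
    (isomorphismVia? halve unhalve (Cay 10 S) K55 ⊎-dec
     any? (λ (f , g) → isomorphismVia? f g (Cay 10 S) C1-2-5) _ ⊎-dec
     any? (isInternalPartition? (Cay 10 S)) _))

order-10 : ∀ S → Order10Certificate S →
  ¬ (Cay 10 S ≅ K55) → ¬ (Cay 10 S ≅ C1-2-5) → InternalPartition (Cay 10 S)
order-10 S (inj₁ iso)          ¬K55 ¬C125 = ⊥-elim (¬K55 (IsomorphismVia⇒≅ halve unhalve (Cay 10 S) K55 iso))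
order-10 S (inj₂ (inj₁ isos))  ¬K55 ¬C125 with satisfied isos
... | (f , g) , iso = ⊥-elim (¬C125 (IsomorphismVia⇒≅ f g (Cay 10 S) C1-2-5 iso))
order-10 S (inj₂ (inj₂ parts)) ¬K55 ¬C125 = satisfied parts

mainTheorem9 : (n : ℕ) .{{_ : NonZero n}} (S : Subset n) →
    ConnectionSet n S → ∣ S ∣ ≡ 5 →
    ¬ (Cay n S ≅ K6) → ¬ (Cay n S ≅ K55) → ¬ (Cay n S ≅ C1-2-5) →
    InternalPartition (Cay n S)
mainTheorem9 n S S-connection |S|≡5 ¬K6 ¬K55 ¬C125 with n ≟ 6 | n ≟ 10
... | yes refl | _        = ⊥-elim (¬K6 (order-6 S S-connection |S|≡5))
... | no _     | yes refl = order-10 S (order-10-certificate S S-connection |S|≡5) ¬K55 ¬C125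
... | no n≢6   | no n≢10  =
  general-case σ 3≤H (λ H≡3 → n≢6 (trans n≡2h (cong (2 *_) H≡3)))
                     (λ H≡5 → n≢10 (trans n≡2h (cong (2 *_) H≡5)))
  where
  σ : Shape S
  σ = shape S S-connection |S|≡5
  open Shape σ
  3≤H : 3 ≤ toℕ h
  3≤H = *-cancelˡ-< 2 2 (toℕ h) (subst (5 ≤_) n≡2h (subst (_≤ n) |S|≡5 (∣p∣≤n S)))
  instance
    H-nonZero : NonZero (toℕ h)
    H-nonZero = >-nonZero (≤-trans (s≤s z≤n) 3≤H)
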